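{- Let $G$ be a graph on $n$ vertices, let $p\geq 2$ be a prime, and let $k\geq 1$ be an integer. Then $$\omega(G^{k_{(p)}})\leq\binom{kn+p-1}{p-1},$$ and if $I$ is a set of vertices that is independent both in $G^{k_{(p)}}$ and in $\overline{G}^{\wedge k}$, then $$|I|\leq\binom{kn+\lfloor k/p\rfloor}{\lfloor k/p\rfloor}.$$ Moreover, if in addition $G$ is regular, then $$\omega(G^{k_{(p)}})\leq\binom{k(n-1)+p}{p-1}\quad\text{and}\quad |I|\leq\binom{k(n-1)+\lfloor k/p\rfloor+1}{\lfloor k/p\rfloor}.$$
   Context: $G^{k_{(p)}}$ is the graph with vertex set $V(G)^k$ in which $(u_1,\dots,u_k)$ and $(v_1,\dots,v_k)$ are adjacent iff $|\{i: u_iv_i\in E(G)\}|\not\equiv 0\pmod p$. $\overline{G}$ is the complement of $G$. For a graph $F$, the strong power $F^{\wedge k}$ is the graph on $V(F)^k$ in which two distinct $k$-tuples $u\neq v$ are adjacent iff for every $i$, $u_i=v_i$ or $u_iv_i\in E(F)$. $\omega$ denotes the clique number. -}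

module Defs where

open import Data.Nat using (ℕ; zero; suc; _+_; _*_; _∸_; _≤_; _/_; _%_; NonZero)
open import Data.Nat.Primality using (Prime)
open import Data.Nat.Combinatorics using (_C_)
open import Data.Bool using (Bool; true; false; T)
open import Data.Fin using (Fin)
open import Data.Vec using (Vec; lookup)
open import Data.List using (List; length; filter)
open import Data.List.Relation.Unary.AllPairs using (AllPairs)
open import Data.List.Membership.Propositional using (_∈_)
open import Data.Product using (Σ; ∃; _×_; _,_)
open import Relation.Nullary using (¬_)
open import Relation.Binary.PropositionalEquality using (_≡_; _≢_)
open import Data.Fin.Base using (toℕ)
open import Data.List using (allFin)

record Graph (n : ℕ) : Set where
  field
    adj   : Fin n → Fin n → Bool
    sym   : ∀ u v → adj u v ≡ adj v u
    irrefl : ∀ u → adj u u ≡ false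
open Graph public

Edge : ∀ {n} → Graph n → Fin n → Fin n → Set
Edge G u v = T (adj G u v)

CoEdge : ∀ {n} → Graph n → Fin n → Fin n → Set
CoEdge G u v = (u ≢ v) × ¬ Edge G u v

countEdges : ∀ {n} → Graph n → ∀ {k} → Vec (Fin n) k → Vec (Fin n) k → ℕ
countEdges G {k} u v = length (filter (λ i → Data.Bool._≟_ (adj G (lookup u i) (lookup v i)) true) (allFin k))
  where import Data.Bool

-- Adjacency in G^{k_(p)}: the count is not ≡ 0 (mod p)
PowAdj : ∀ {n} → Graph n → (p : ℕ) → .{{_ : NonZero p}} → ∀ {k} →
         Vec (Fin n) k → Vec (Fin n) k → Set
PowAdj G p u v = countEdges G u v % p ≢ 0

StrongCoAdj : ∀ {n} → Graph n → ∀ {k} → Vec (Fin n) k → Vec (Fin n) k → Set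
StrongCoAdj G {k} u v = (u ≢ v) × (∀ (i : Fin k) → (lookup u i ≡ lookup v i) Data.Sum.⊎ CoEdge G (lookup u i) (lookup v i))
  where import Data.Sum

IsClique : {V : Set} → (V → V → Set) → List V → Set
IsClique R xs = AllPairs (λ x y → (x ≢ y) × R x y) xs

IsIndependent : {V : Set} → (V → V → Set) → List V → Set
IsIndependent R xs = AllPairs (λ x y → (x ≢ y) × ¬ R x y) xs

CliqueNumberAtMost : {V : Set} → (V → V → Set) → ℕ → Set
CliqueNumberAtMost R B = ∀ xs → IsClique R xs → length xs ≤ B

degree : ∀ {n} → Graph n → Fin n → ℕ
degree {n} G v = length (filter (λ w → Data.Bool._≟_ (adj G v w) true) (allFin n))
  where import Data.Bool

IsRegular : ∀ {n} → Graph n → Set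
IsRegular {n} G = ∃ λ d → ∀ (v : Fin n) → degree G v ≡ d

-- For a vertex u, the number of coordinates in which u and v are adjacent is an
-- affine function of v in the k(n−1) indicator variables [vᵢ = b], b ≠ 0.
-- For a clique, the polynomials ∏_{j=1}^{p−1} (j − count(xᵤ, v)) vanish mod p at
-- every other clique vertex but not at xᵤ itself; for an independent set of the
-- kind considered, ∏_{j=1}^{⌊k/p⌋} (jp − count(xᵤ, v)) vanishes exactly off the
-- diagonal. Such a diagonal family is linearly independent (over 𝔽ₚ, resp. ℚ),
-- and it lies in the span of the monomials of degree ≤ d in k(n−1) variables,
-- so its size is at most C(k(n−1)+d, d). This bound needs no regularity and
-- implies all four inequalities.
module Submission where

open import Defs hiding (sym)
open import Data.Nat as ℕ using (ℕ; zero; suc; z≤n; s≤s; _≤_; _∸_; _/_; _%_; NonZero)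
import Data.Nat.Properties as ℕP
import Data.Nat.Divisibility as ℕD
import Data.Nat.DivMod as ℕD
open import Data.Nat.Combinatorics using (_C_; nCn≡1; nCk+nC[k+1]≡[n+1]C[k+1])
open import Data.Nat.Primality using (Prime; prime⇒nonTrivial; euclidsLemma; ¬prime[0])
open import Data.Integer as ℤ using (ℤ; +_; 0ℤ; 1ℤ; -_)
import Data.Integer.Properties as ℤP
import Data.Integer.Divisibility.Signed as ℤD
open import Data.Integer.Tactic.RingSolver using (solve-∀)
open import Algebra.Properties.Semiring.Sum ℤP.+-*-semiring using (sum-syntax; *-distribʳ-sum)
open import Data.Bool as Bool using (true; false)
open import Data.Bool.Properties using (T-≡)
open import Data.Fin as Fin using (Fin; zero; suc; toℕ; fromℕ<; punchIn; combine; remQuot)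
import Data.Fin.Properties as FinP
open import Data.Vec using (Vec; _∷_; lookup)
open import Data.List as List using (List; []; _∷_; _++_; [_]; length; map; filter; tabulate; allFin)
import Data.List.Properties as ListP
open import Data.List.Membership.Propositional using (_∈_)
open import Data.List.Membership.Propositional.Properties
  using (∈-map⁺; ∈-map⁻; ∈-++⁺ˡ; ∈-++⁺ʳ; ∈-++⁻; ∈-tabulate⁺; ∈-allFin; ∈-filter⁺; ∈-lookup)
open import Data.List.Relation.Unary.Any using (here; there)
open import Data.List.Relation.Unary.All as All using (universal)
open import Data.List.Relation.Unary.AllPairs as AllPairs using (AllPairs; _∷_)
open import Data.Product using (_×_; ∃; _,_; proj₁; proj₂; uncurry)
open import Data.Sum using (_⊎_; inj₁; inj₂; [_,_]′)
open import Function using (_∘_; const; Equivalence)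
open import Relation.Nullary using (¬_; Dec; yes; no; ¬?; contradiction)
open import Relation.Nullary.Decidable using (decidable-stable; map′)
open import Relation.Binary.PropositionalEquality hiding ([_])

module _ where
  open import Data.Integer using (_+_; _*_; _-_)

  record DecPrimeIdeal : Set₁ where
    field
      Member   : ℤ → Set
      member?  : ∀ a → Dec (Member a)
      0∈       : Member 0ℤ
      +-closed : ∀ {a b} → Member a → Member b → Member (a + b)
      *-closed : ∀ c {a} → Member a → Member (c * a)
      1∉       : ¬ Member 1ℤ
      prime    : ∀ {a b} → ¬ Member a → ¬ Member b → ¬ Member (a * b)

    *-closedʳ : ∀ c {a} → Member a → Member (a * c)
    *-closedʳ c {a} a∈ = subst Member (ℤP.*-comm c a) (*-closed c a∈)

    -‿closed : ∀ {a b} → Member a → Member b → Member (a - b)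
    -‿closed {a} {b} a∈ b∈ = subst Member (minus a b) (+-closed a∈ (*-closed (- 1ℤ) b∈))
      where
        minus : ∀ a b → a + (- 1ℤ) * b ≡ a - b
        minus = solve-∀

  multiplesOfPrime : ∀ p → Prime p → DecPrimeIdeal
  multiplesOfPrime p p-prime = record
    { Member   = (+ p) ℤD.∣_
    ; member?  = λ a → map′ ℤD.∣ᵤ⇒∣ ℤD.∣⇒∣ᵤ (p ℕD.∣? ℤ.∣ a ∣)
    ; 0∈       = ℤD.divides 0ℤ refl
    ; +-closed = ℤD.∣m∣n⇒∣m+n
    ; *-closed = ℤD.∣n⇒∣m*n
    ; 1∉       = λ p∣1 → ℕP.<⇒≢ (ℕ.nonTrivial⇒n>1 p {{prime⇒nonTrivial p-prime}})
                                   (sym (ℕD.∣1⇒≡1 (ℤD.∣⇒∣ᵤ p∣1)))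
    ; prime    = λ {a} {b} p∤a p∤b p∣ab →
        [ p∤a ∘ ℤD.∣ᵤ⇒∣ , p∤b ∘ ℤD.∣ᵤ⇒∣ ]′
          (euclidsLemma ℤ.∣ a ∣ ℤ.∣ b ∣ p-prime (subst (p ℕD.∣_) (ℤP.abs-* a b) (ℤD.∣⇒∣ᵤ p∣ab)))
    }

  zeroIdeal : DecPrimeIdeal
  zeroIdeal = record
    { Member   = _≡ 0ℤ
    ; member?  = ℤ._≟ 0ℤ
    ; 0∈       = refl
    ; +-closed = λ { refl refl → refl }
    ; *-closed = λ { c refl → ℤP.*-zeroʳ c }
    ; 1∉       = λ ()
    ; prime    = λ {a} a≢0 b≢0 ab≡0 → [ a≢0 , b≢0 ]′ (ℤP.i*j≡0⇒i≡0∨j≡0 a ab≡0)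
    }

-- Spans of integer-valued functions

module _ {X : Set} where
  open import Data.Integer using (_+_; _*_; _-_)

  infixl 7 _·_

  _·_ : (X → ℤ) → (X → ℤ) → X → ℤ
  (f · g) x = f x * g x

  data Span (gs : List (X → ℤ)) : (X → ℤ) → Set where
    span-zero : Span gs (const 0ℤ)
    span-gen  : ∀ {g} → g ∈ gs → Span gs g
    span-+    : ∀ {f h} → Span gs f → Span gs h → Span gs (λ x → f x + h x)
    span-*    : ∀ c {f} → Span gs f → Span gs (λ x → c * f x)
    span-≗    : ∀ {f h} → f ≗ h → Span gs f → Span gs h

  span-bind : ∀ {gs hs f} → (∀ {g} → g ∈ gs → Span hs g) → Span gs f → Span hs f
  span-bind s span-zero       = span-zero
  span-bind s (span-gen g∈)   = s g∈
  span-bind s (span-+ f∈ h∈)  = span-+ (span-bind s f∈) (span-bind s h∈)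
  span-bind s (span-* c f∈)   = span-* c (span-bind s f∈)
  span-bind s (span-≗ eq f∈)  = span-≗ eq (span-bind s f∈)

  span-·ˡ : ∀ {gs hs f} w → (∀ {g} → g ∈ gs → Span hs (w · g)) → Span gs f → Span hs (w · f)
  span-·ˡ w s span-zero      = span-≗ (λ x → sym (ℤP.*-zeroʳ (w x))) span-zero
  span-·ˡ w s (span-gen g∈)  = s g∈
  span-·ˡ w s (span-+ f∈ h∈) =
    span-≗ (λ x → sym (ℤP.*-distribˡ-+ (w x) _ _)) (span-+ (span-·ˡ w s f∈) (span-·ˡ w s h∈))
  span-·ˡ w s (span-* c f∈)  = span-≗ (λ x → *-swap (w x) c _) (span-* c (span-·ˡ w s f∈))
    where
      *-swap : ∀ a b c → b * (a * c) ≡ a * (b * c)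
      *-swap = solve-∀
  span-·ˡ w s (span-≗ eq f∈) = span-≗ (λ x → cong (w x *_) (eq x)) (span-·ˡ w s f∈)

  span-[] : ∀ {f} → Span [] f → f ≗ const 0ℤ
  span-[] span-zero      x = refl
  span-[] (span-+ f∈ h∈) x = cong₂ _+_ (span-[] f∈ x) (span-[] h∈ x)
  span-[] (span-* c f∈)  x = trans (cong (c *_) (span-[] f∈ x)) (ℤP.*-zeroʳ c)
  span-[] (span-≗ eq f∈) x = trans (sym (eq x)) (span-[] f∈ x)

  span-∷⁻ : ∀ {g gs f} → Span (g ∷ gs) f → ∃ λ c → Span gs (λ x → f x - c * g x)
  span-∷⁻ {g} span-zero = 0ℤ , span-≗ (λ x → sym (zero-case (g x))) span-zero
    where
      zero-case : ∀ a → 0ℤ - 0ℤ * a ≡ 0ℤ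
      zero-case = solve-∀
  span-∷⁻ {g} (span-gen (here refl)) = 1ℤ , span-≗ (λ x → sym (self-case (g x))) span-zero
    where
      self-case : ∀ a → a - 1ℤ * a ≡ 0ℤ
      self-case = solve-∀
  span-∷⁻ {g} {f = f} (span-gen (there f∈)) = 0ℤ , span-≗ (λ x → sym (other-case (f x) (g x))) (span-gen f∈)
    where
      other-case : ∀ a b → a - 0ℤ * b ≡ a
      other-case = solve-∀
  span-∷⁻ {g} (span-+ {f} {h} f∈ h∈) with span-∷⁻ f∈ | span-∷⁻ h∈
  ... | c , f′∈ | d , h′∈ = c + d , span-≗ (λ x → sym (sum-case (f x) (h x) c d (g x))) (span-+ f′∈ h′∈)
    where
      sum-case : ∀ a b c d g → (a + b) - (c + d) * g ≡ (a - c * g) + (b - d * g)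
      sum-case = solve-∀
  span-∷⁻ {g} (span-* k {f} f∈) with span-∷⁻ f∈
  ... | c , f′∈ = k * c , span-≗ (λ x → sym (scale-case k (f x) c (g x))) (span-* k f′∈)
    where
      scale-case : ∀ k a c g → k * a - (k * c) * g ≡ k * (a - c * g)
      scale-case = solve-∀
  span-∷⁻ (span-≗ eq f∈) with span-∷⁻ f∈
  ... | c , f′∈ = c , span-≗ (λ x → cong (_- _) (eq x)) f′∈

  span-∑ : ∀ {gs} m (h : Fin m → X → ℤ) → (∀ a → Span gs (h a)) → Span gs (λ x → ∑[ a < m ] h a x)
  span-∑ zero    h s = span-zero
  span-∑ (suc m) h s = span-+ (s zero) (span-∑ m (h ∘ suc) (s ∘ suc))

  prod : ∀ d → (Fin d → X → ℤ) → X → ℤ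
  prod zero    A = const 1ℤ
  prod (suc d) A = A zero · prod d (A ∘ suc)

-- Diagonal families

module Rank (I : DecPrimeIdeal) {X : Set} where
  open import Data.Integer using (_+_; _*_; _-_)
  open DecPrimeIdeal I

  prod-∈ : ∀ d (A : Fin d → X → ℤ) x j → Member (A j x) → Member (prod d A x)
  prod-∈ (suc d) A x zero    A₀∈ = *-closedʳ (prod d (A ∘ suc) x) A₀∈
  prod-∈ (suc d) A x (suc j) Aⱼ∈ = *-closed (A zero x) (prod-∈ d (A ∘ suc) x j Aⱼ∈)

  prod-∉ : ∀ d (A : Fin d → X → ℤ) x → (∀ j → ¬ Member (A j x)) → ¬ Member (prod d A x)
  prod-∉ zero    A x A∉ = 1∉
  prod-∉ (suc d) A x A∉ = prime (A∉ zero) (prod-∉ d (A ∘ suc) x (A∉ ∘ suc))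

  record DiagonalFamily (gs : List (X → ℤ)) (m : ℕ) : Set where
    field
      f            : Fin m → X → ℤ
      y            : Fin m → X
      f∈span       : ∀ u → Span gs (f u)
      off-diagonal : ∀ {u w} → u ≢ w → Member (f u (y w))
      diagonal     : ∀ u → ¬ Member (f u (y u))

  module _ {g gs m} (F : DiagonalFamily (g ∷ gs) m) where
    open DiagonalFamily F

    coefficient : Fin m → ℤ
    coefficient u = proj₁ (span-∷⁻ (f∈span u))

    residual∈span : ∀ u → Span gs (λ x → f u x - coefficient u * g x)
    residual∈span u = proj₂ (span-∷⁻ (f∈span u))

    drop-generator : (∀ u → Member (coefficient u)) → DiagonalFamily gs m
    drop-generator c∈ = record
      { f            = λ u x → f u x - coefficient u * g x
      ; y            = y
      ; f∈span       = residual∈span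
      ; off-diagonal = λ u≢w → -‿closed (off-diagonal u≢w) (cg∈ _ _)
      ; diagonal     = λ u r∈ → diagonal u
          (subst Member (add-back (f u (y u)) (coefficient u) (g (y u))) (+-closed r∈ (cg∈ u (y u))))
      }
      where
        cg∈ : ∀ u x → Member (coefficient u * g x)
        cg∈ u x = *-closedʳ (g x) (c∈ u)
        add-back : ∀ a c b → (a - c * b) + c * b ≡ a
        add-back = solve-∀

  -- Gaussian elimination with pivot u₀: fᵤ ↦ c₀ fᵤ − cᵤ f₀ removes the first generator.
  pivot : ∀ {g gs m} (F : DiagonalFamily (g ∷ gs) (suc m)) u₀ →
          ¬ Member (coefficient F u₀) → DiagonalFamily gs m
  pivot {g} {gs} {m} F u₀ c₀∉ = record
    { f            = f′
    ; y            = y ∘ punchIn u₀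
    ; f∈span       = λ u → span-≗ (λ x → eliminate (c u₀) (f (punchIn u₀ u) x) (c (punchIn u₀ u)) (g x) (f u₀ x))
                       (span-+ (span-* (c u₀) (residual∈span F (punchIn u₀ u)))
                               (span-* (- c (punchIn u₀ u)) (residual∈span F u₀)))
    ; off-diagonal = λ {u} {w} u≢w →
        -‿closed (*-closed (c u₀) (off-diagonal (u≢w ∘ FinP.punchIn-injective u₀ u w)))
                 (*-closed (c (punchIn u₀ u)) (f₀-off w))
    ; diagonal     = λ u f′∈ → prime c₀∉ (diagonal (punchIn u₀ u))
        (subst Member (sub-add (c u₀ * f (punchIn u₀ u) (y (punchIn u₀ u))) _)
               (+-closed f′∈ (*-closed (c (punchIn u₀ u)) (f₀-off u))))
    }
    where
      open DiagonalFamily F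
      c : Fin (suc m) → ℤ
      c = coefficient F
      f′ : Fin m → X → ℤ
      f′ u x = c u₀ * f (punchIn u₀ u) x - c (punchIn u₀ u) * f u₀ x
      f₀-off : ∀ w → Member (f u₀ (y (punchIn u₀ w)))
      f₀-off w = off-diagonal (FinP.punchInᵢ≢i u₀ w ∘ sym)
      eliminate : ∀ c₀ a cᵤ b a₀ → c₀ * (a - cᵤ * b) + (- cᵤ) * (a₀ - c₀ * b) ≡ c₀ * a - cᵤ * a₀
      eliminate = solve-∀
      sub-add : ∀ a b → (a - b) + b ≡ a
      sub-add = solve-∀

  diagonalFamily-size : ∀ {gs m} → DiagonalFamily gs m → m ≤ length gs
  diagonalFamily-size {[]} {zero} F = z≤n
  diagonalFamily-size {[]} {suc m} F =
    contradiction (subst Member (sym (span-[] (f∈span zero) (y zero))) 0∈) (diagonal zero)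
    where open DiagonalFamily F
  diagonalFamily-size {g ∷ gs} F with FinP.any? (λ u → ¬? (member? (coefficient F u)))
  ... | no all∈ = ℕP.m≤n⇒m≤1+n (diagonalFamily-size (drop-generator F c∈))
    where
      c∈ : ∀ u → Member (coefficient F u)
      c∈ u = decidable-stable (member? _) (λ c∉ → all∈ (u , c∉))
  diagonalFamily-size {g ∷ gs} {suc m} F | yes (u₀ , c₀∉) = s≤s (diagonalFamily-size (pivot F u₀ c₀∉))

-- Monomials

module _ {X : Set} where
  open import Data.Integer using (_*_)

  monomials : List (X → ℤ) → ℕ → List (X → ℤ)
  monomials ws       zero    = [ const 1ℤ ]
  monomials []       (suc d) = []
  monomials (w ∷ ws) (suc d) = monomials ws (suc d) ++ map (w ·_) (monomials (w ∷ ws) d)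

  length-monomials : ∀ w ws d → length (monomials (w ∷ ws) d) ≡ (length ws ℕ.+ d) C d
  length-monomials w ws zero = refl
  length-monomials w [] (suc d) = begin
    length (map (w ·_) (monomials (w ∷ []) d)) ≡⟨ ListP.length-map (w ·_) (monomials (w ∷ []) d) ⟩
    length (monomials (w ∷ []) d)              ≡⟨ length-monomials w [] d ⟩
    d C d                                      ≡⟨ nCn≡1 d ⟩
    1                                          ≡⟨ nCn≡1 (suc d) ⟨
    suc d C suc d                              ∎
    where open ≡-Reasoning
  length-monomials w (w′ ∷ ws) (suc d) = begin
    length (monomials (w′ ∷ ws) (suc d) ++ map (w ·_) (monomials (w ∷ w′ ∷ ws) d))
      ≡⟨ ListP.length-++ (monomials (w′ ∷ ws) (suc d)) ⟩
    length (monomials (w′ ∷ ws) (suc d)) ℕ.+ length (map (w ·_) (monomials (w ∷ w′ ∷ ws) d))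
      ≡⟨ cong (length (monomials (w′ ∷ ws) (suc d)) ℕ.+_) (ListP.length-map (w ·_) (monomials (w ∷ w′ ∷ ws) d)) ⟩
    length (monomials (w′ ∷ ws) (suc d)) ℕ.+ length (monomials (w ∷ w′ ∷ ws) d)
      ≡⟨ cong₂ ℕ._+_ (length-monomials w′ ws (suc d)) (length-monomials w (w′ ∷ ws) d) ⟩
    (L ℕ.+ suc d) C suc d ℕ.+ (suc L ℕ.+ d) C d
      ≡⟨ cong (λ t → (L ℕ.+ suc d) C suc d ℕ.+ t C d) (sym (ℕP.+-suc L d)) ⟩
    (L ℕ.+ suc d) C suc d ℕ.+ (L ℕ.+ suc d) C d
      ≡⟨ ℕP.+-comm ((L ℕ.+ suc d) C suc d) _ ⟩
    (L ℕ.+ suc d) C d ℕ.+ (L ℕ.+ suc d) C suc d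
      ≡⟨ nCk+nC[k+1]≡[n+1]C[k+1] (L ℕ.+ suc d) d ⟩
    suc (L ℕ.+ suc d) C suc d
      ∎
    where
      open ≡-Reasoning
      L = length ws

  ·-monomial∈span : ∀ ws d {w h} → w ∈ ws → h ∈ monomials ws d → Span (monomials ws (suc d)) (w · h)
  ·-monomial∈span (w ∷ ws) zero (here refl) (here refl) =
    span-gen (∈-++⁺ʳ (monomials ws 1) (here refl))
  ·-monomial∈span (w′ ∷ ws) zero (there w∈) (here refl) =
    span-bind (span-gen ∘ ∈-++⁺ˡ) (·-monomial∈span ws zero w∈ (here refl))
  ·-monomial∈span (w′ ∷ ws) (suc d) {w} w∈ h∈ with ∈-++⁻ (monomials ws (suc d)) h∈ | w∈
  ... | inj₁ h∈ws | here refl =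
    span-gen (∈-++⁺ʳ (monomials ws (suc (suc d))) (∈-map⁺ (w′ ·_) (∈-++⁺ˡ h∈ws)))
  ... | inj₁ h∈ws | there w∈ws =
    span-bind (span-gen ∘ ∈-++⁺ˡ) (·-monomial∈span ws (suc d) w∈ws h∈ws)
  ... | inj₂ h∈w′· | _ with ∈-map⁻ (w′ ·_) h∈w′·
  ...   | h′ , h′∈ , refl =
    span-≗ (λ x → *-swap (w′ x) (w x) (h′ x))
      (span-·ˡ w′ (span-gen ∘ ∈-++⁺ʳ (monomials ws (suc (suc d))) ∘ ∈-map⁺ (w′ ·_))
        (·-monomial∈span (w′ ∷ ws) d w∈ h′∈))
    where
      *-swap : ∀ a b c → a * (b * c) ≡ b * (a * c)
      *-swap = solve-∀

  ·-span∈span-monomials : ∀ ws d {A g} → Span ws A → Span (monomials ws d) g →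
                          Span (monomials ws (suc d)) (A · g)
  ·-span∈span-monomials ws d {A} {g} A∈ g∈ =
    span-≗ (λ x → ℤP.*-comm (g x) (A x))
      (span-·ˡ g (λ {w} w∈ → span-≗ (λ x → ℤP.*-comm (w x) (g x))
                               (span-·ˡ w (·-monomial∈span ws d w∈) g∈))
        A∈)

  prod∈span-monomials : ∀ ws d (A : Fin d → X → ℤ) → (∀ j → Span ws (A j)) →
                        Span (monomials ws d) (prod d A)
  prod∈span-monomials ws zero    A A∈ = span-gen (here refl)
  prod∈span-monomials ws (suc d) A A∈ =
    ·-span∈span-monomials ws d (A∈ zero) (prod∈span-monomials ws d (A ∘ suc) (A∈ ∘ suc))

-- The polynomial method

allPairs-lookup : ∀ {A : Set} {R : A → A → Set} → (∀ {x y} → R x y → R y x) →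
                  ∀ {xs} → AllPairs R xs → ∀ {u w} → u ≢ w → R (List.lookup xs u) (List.lookup xs w)
allPairs-lookup R-sym (_ ∷ _)   {zero}  {zero}  u≢w = contradiction refl u≢w
allPairs-lookup R-sym (Rx ∷ _)  {zero}  {suc w} u≢w = All.lookup Rx (∈-lookup w)
allPairs-lookup R-sym (Rx ∷ _)  {suc u} {zero}  u≢w = R-sym (All.lookup Rx (∈-lookup u))
allPairs-lookup R-sym (_ ∷ Rxs) {suc u} {suc w} u≢w = allPairs-lookup R-sym Rxs (u≢w ∘ cong suc)

module _ (I : DecPrimeIdeal) {X : Set} (ws : List (X → ℤ))
         (F : X → X → ℤ) (F∈span : ∀ x → Span (const 1ℤ ∷ ws) (F x))
         (F-sym : ∀ x y → F x y ≡ F y x) (F-self : ∀ x → F x x ≡ 0ℤ) where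
  open import Data.Integer using (_+_; _*_; _-_)
  open DecPrimeIdeal I
  open Rank I

  -- The polynomials ∏ⱼ (cⱼ − F xᵤ ·) form a diagonal family with respect to the points xᵤ.
  polynomial-method : ∀ d (c : Fin d → ℤ) → (∀ j → ¬ Member (c j)) →
                      ∀ xs → AllPairs (λ x y → ∃ λ j → Member (c j - F x y)) xs →
                      length xs ≤ (length ws ℕ.+ d) C d
  polynomial-method d c diag xs pairs = subst (length xs ≤_) (length-monomials (const 1ℤ) ws d)
    (diagonalFamily-size (record
      { f            = λ u → prod d (factor u)
      ; y            = point
      ; f∈span       = λ u → prod∈span-monomials (const 1ℤ ∷ ws) d (factor u) (factor∈span u)
      ; off-diagonal = λ u≢w → let j , c-F∈ = allPairs-lookup related-sym pairs u≢w
                               in prod-∈ d (factor _) _ j c-F∈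
      ; diagonal     = λ u → prod-∉ d (factor u) (point u) (λ j → diag j ∘ subst Member (c-F-self j (point u)))
      }))
    where
      point : Fin (length xs) → X
      point = List.lookup xs
      factor : Fin (length xs) → Fin d → X → ℤ
      factor u j x = c j - F (point u) x
      affine : ∀ a b → a * 1ℤ + (- 1ℤ) * b ≡ a - b
      affine = solve-∀
      factor∈span : ∀ u j → Span (const 1ℤ ∷ ws) (factor u j)
      factor∈span u j = span-≗ (λ x → affine (c j) (F (point u) x))
        (span-+ (span-* (c j) (span-gen (here refl))) (span-* (- 1ℤ) (F∈span (point u))))
      c-F-self : ∀ j x → c j - F x x ≡ c j
      c-F-self j x = trans (cong (λ t → c j - t) (F-self x)) (ℤP.+-identityʳ (c j))
      related-sym : ∀ {x y} → (∃ λ j → Member (c j - F x y)) → ∃ λ j → Member (c j - F y x)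
      related-sym {x} {y} (j , c-F∈) = j , subst (λ t → Member (c j - t)) (F-sym x y) c-F∈

module _ where
  open import Data.Integer using (_+_; _*_; _-_)

  δ : ∀ {n} → Fin n → Fin n → ℤ
  δ zero    zero    = 1ℤ
  δ zero    (suc _) = 0ℤ
  δ (suc _) zero    = 0ℤ
  δ (suc b) (suc a) = δ b a

  ∑-*-zeroʳ : ∀ m (g : Fin m → ℤ) → ∑[ a < m ] (g a * 0ℤ) ≡ 0ℤ
  ∑-*-zeroʳ m g = trans (sym (*-distribʳ-sum 0ℤ g)) (ℤP.*-zeroʳ (∑[ a < m ] g a))

  ∑-δ : ∀ {m} (g : Fin m → ℤ) b → ∑[ a < m ] (g a * δ b a) ≡ g b
  ∑-δ {suc m} g zero = begin
    g zero * 1ℤ + ∑[ a < m ] (g (suc a) * 0ℤ) ≡⟨ cong₂ _+_ (ℤP.*-identityʳ (g zero)) (∑-*-zeroʳ m (g ∘ suc)) ⟩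
    g zero + 0ℤ                                     ≡⟨ ℤP.+-identityʳ (g zero) ⟩
    g zero                                          ∎
    where open ≡-Reasoning
  ∑-δ {suc m} g (suc b) = begin
    g zero * 0ℤ + ∑[ a < m ] (g (suc a) * δ b a) ≡⟨ cong₂ _+_ (ℤP.*-zeroʳ (g zero)) (∑-δ (g ∘ suc) b) ⟩
    0ℤ + g (suc b)                                     ≡⟨ ℤP.+-identityˡ (g (suc b)) ⟩
    g (suc b)                                          ∎
    where open ≡-Reasoning

  δ-expansion : ∀ {m} (F : Fin (suc m) → ℤ) b →
                F b ≡ F zero * 1ℤ + ∑[ a < m ] ((F (suc a) - F zero) * δ b (suc a))
  δ-expansion {m} F zero = sym (begin
    F zero * 1ℤ + ∑[ a < m ] ((F (suc a) - F zero) * 0ℤ)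
      ≡⟨ cong₂ _+_ (ℤP.*-identityʳ (F zero)) (∑-*-zeroʳ m (λ a → F (suc a) - F zero)) ⟩
    F zero + 0ℤ
      ≡⟨ ℤP.+-identityʳ (F zero) ⟩
    F zero ∎)
    where open ≡-Reasoning
  δ-expansion {m} F (suc b) = sym (begin
    F zero * 1ℤ + ∑[ a < m ] ((F (suc a) - F zero) * δ b a)
      ≡⟨ cong (λ t → F zero * 1ℤ + t) (∑-δ (λ a → F (suc a) - F zero) b) ⟩
    F zero * 1ℤ + (F (suc b) - F zero)
      ≡⟨ cancel (F zero) (F (suc b)) ⟩
    F (suc b) ∎)
    where
      open ≡-Reasoning
      cancel : ∀ a b → a * 1ℤ + (b - a) ≡ b
      cancel = solve-∀

module _ {n} (G : Graph n) {k : ℕ} where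

  adjacentAt? : ∀ (u v : Vec (Fin n) k) i → Dec (adj G (lookup u i) (lookup v i) ≡ true)
  adjacentAt? u v i = adj G (lookup u i) (lookup v i) Bool.≟ true

  countEdges-sym : ∀ u v → countEdges G {k} u v ≡ countEdges G v u
  countEdges-sym u v = cong length (ListP.filter-≐ (adjacentAt? u v) (adjacentAt? v u)
    ((λ {i} → trans (Graph.sym G (lookup v i) (lookup u i))) , (λ {i} → trans (Graph.sym G (lookup u i) (lookup v i))))
    (allFin k))

  countEdges-self : ∀ u → countEdges G {k} u u ≡ 0
  countEdges-self u = cong length (ListP.filter-none (adjacentAt? u u)
    (universal (λ i loop → contradiction (trans (sym (irrefl G (lookup u i))) loop) λ ()) (allFin k)))

  countEdges≤ : ∀ u v → countEdges G {k} u v ≤ k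
  countEdges≤ u v = subst (countEdges G u v ≤_) (ListP.length-tabulate {n = k} (λ i → i))
    (ListP.length-filter (adjacentAt? u v) (allFin k))

  edge⇒countEdges≢0 : ∀ u v i → Edge G (lookup u i) (lookup v i) → countEdges G {k} u v ≢ 0
  edge⇒countEdges≢0 u v i edge = nonempty
    (∈-filter⁺ (adjacentAt? u v) (∈-allFin i) (Equivalence.to T-≡ edge))
    where
      nonempty : ∀ {A : Set} {x : A} {xs} → x ∈ xs → length xs ≢ 0
      nonempty (here _)  ()
      nonempty (there _) ()

  ¬strongCoAdj⇒countEdges≢0 : ∀ u v → u ≢ v → ¬ StrongCoAdj G {k} u v → countEdges G u v ≢ 0
  ¬strongCoAdj⇒countEdges≢0 u v u≢v ¬uv count≡0 = ¬uv (u≢v , coordinate)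
    where
      coordinate : ∀ i → (lookup u i ≡ lookup v i) ⊎ CoEdge G (lookup u i) (lookup v i)
      coordinate i with lookup u i FinP.≟ lookup v i
      ... | yes uᵢ≡vᵢ = inj₁ uᵢ≡vᵢ
      ... | no uᵢ≢vᵢ  = inj₂ (uᵢ≢vᵢ , λ edge → edge⇒countEdges≢0 u v i edge count≡0)

module _ where
  open import Data.Integer using (_+_; _*_; _-_)

  nonzero-residue : ∀ p′ N → N % suc p′ ≢ 0 → ∃ λ (j : Fin p′) → (+ suc p′) ℤD.∣ (+ suc (toℕ j) - + N)
  nonzero-residue p′ N N%p≢0 with N % p | ℕD.m≡m%n+[m/n]*n N p | ℕD.m%n<n N p
    where p = suc p′
  ... | zero  | _ | _ = contradiction refl N%p≢0
  ... | suc r | N≡ | s≤s r<p′ = fromℕ< r<p′ , ℤD.divides (- + (N / p)) (begin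
      + suc (toℕ (fromℕ< r<p′)) - + N           ≡⟨ cong₂ (λ a b → + suc a - + b) (FinP.toℕ-fromℕ< r<p′) N≡ ⟩
      + suc r - + (suc r ℕ.+ N / p ℕ.* p)       ≡⟨ cong (λ t → + suc r - t) (ℤP.pos-+ (suc r) (N / p ℕ.* p)) ⟩
      + suc r - (+ suc r + + (N / p ℕ.* p))     ≡⟨ cong (λ t → + suc r - (+ suc r + t)) (ℤP.pos-* (N / p) p) ⟩
      + suc r - (+ suc r + + (N / p) * + p)     ≡⟨ cancel (+ suc r) (+ (N / p)) (+ p) ⟩
      (- + (N / p)) * + p                       ∎)
    where
      p = suc p′
      open ≡-Reasoning
      cancel : ∀ r q p → r - (r + q * p) ≡ (- q) * p
      cancel = solve-∀

  small-nondivisible : ∀ p′ (j : Fin p′) → ¬ (+ suc p′) ℤD.∣ + suc (toℕ j)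
  small-nondivisible p′ j p∣ = ℕP.<⇒≱ (s≤s (FinP.toℕ<n j)) (ℕD.∣⇒≤ (ℤD.∣⇒∣ᵤ p∣))

  positive-multiple : ∀ p {k} N .{{_ : NonZero p}} → N % p ≡ 0 → N ≢ 0 → N ≤ k →
                      ∃ λ (j : Fin (k / p)) → suc (toℕ j) ℕ.* p ≡ N
  positive-multiple p N N%p≡0 N≢0 N≤k with N / p | ℕD.m≡m%n+[m/n]*n N p | ℕD./-monoˡ-≤ p N≤k
  ... | zero  | N≡ | _      = contradiction (trans N≡ (cong (ℕ._+ 0) N%p≡0)) N≢0
  ... | suc q | N≡ | q<k/p  = fromℕ< q<k/p ,
    trans (cong (λ t → suc t ℕ.* p) (FinP.toℕ-fromℕ< q<k/p)) (sym (trans N≡ (cong (ℕ._+ suc q ℕ.* p) N%p≡0)))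

-- Powers of graphs

module _ {m} (G : Graph (suc m)) (k : ℕ) where
  open import Data.Integer using (_+_; _*_; _-_)

  Point : Set
  Point = Vec (Fin (suc m)) k

  -- Only the values b ≠ 0 get a variable; [vᵢ = 0] is 1 minus the others.
  indicator : Fin k → Fin m → Point → ℤ
  indicator i a v = δ (lookup v i) (suc a)

  indicators : List (Point → ℤ)
  indicators = tabulate (uncurry indicator ∘ remQuot m)

  indicator∈indicators : ∀ i a → indicator i a ∈ indicators
  indicator∈indicators i a = subst (_∈ indicators) (cong (uncurry indicator) (FinP.remQuot-combine i a))
    (∈-tabulate⁺ (combine i a))

  coordinate-function∈span : ∀ i (F : Fin (suc m) → ℤ) → Span (const 1ℤ ∷ indicators) (λ v → F (lookup v i))
  coordinate-function∈span i F = span-≗ (λ v → sym (δ-expansion F (lookup v i)))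
    (span-+ (span-* (F zero) (span-gen (here refl)))
            (span-∑ m (λ a v → (F (suc a) - F zero) * indicator i a v)
                      (λ a → span-* (F (suc a) - F zero) (span-gen (there (indicator∈indicators i a))))))

  countEdges∈span : ∀ u → Span (const 1ℤ ∷ indicators) (λ v → + countEdges G u v)
  countEdges∈span u = count∈span (allFin k)
    where
      count∈span : ∀ is → Span (const 1ℤ ∷ indicators) (λ v → + length (filter (adjacentAt? G u v) is))
      count∈span []       = span-zero
      count∈span (i ∷ is) = span-≗ add-coordinate
        (span-+ (coordinate-function∈span i (λ b → Bool.if adj G (lookup u i) b then 1ℤ else 0ℤ)) (count∈span is))
        where
          add-coordinate : ∀ v →
            (Bool.if adj G (lookup u i) (lookup v i) then 1ℤ else 0ℤ)
              + + length (filter (adjacentAt? G u v) is)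
            ≡ + length (filter (adjacentAt? G u v) (i ∷ is))
          add-coordinate v with adj G (lookup u i) (lookup v i)
          ... | true  = refl
          ... | false = refl

  length-indicators : length indicators ≡ k ℕ.* m
  length-indicators = ListP.length-tabulate (uncurry indicator ∘ remQuot m)

  edge-count-bound : ∀ I d (c : Fin d → ℤ) → (∀ j → ¬ DecPrimeIdeal.Member I (c j)) →
                     ∀ xs → AllPairs (λ x y → ∃ λ j → DecPrimeIdeal.Member I (c j - + countEdges G x y)) xs →
                     length xs ≤ (k ℕ.* m ℕ.+ d) C d
  edge-count-bound I d c c∉ xs pairs = subst (λ L → length xs ≤ (L ℕ.+ d) C d) length-indicators
    (polynomial-method I indicators (λ x y → + countEdges G x y) countEdges∈span
      (λ x y → cong +_ (countEdges-sym G x y)) (λ x → cong +_ (countEdges-self G x)) d c c∉ xs pairs)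

  clique-bound : ∀ p′ → Prime (suc p′) → CliqueNumberAtMost (PowAdj G (suc p′) {k}) ((k ℕ.* m ℕ.+ p′) C p′)
  clique-bound p′ p-prime xs clique =
    edge-count-bound (multiplesOfPrime (suc p′) p-prime) p′ (λ j → + suc (toℕ j)) (small-nondivisible p′) xs
      (AllPairs.map (λ {x} {y} (_ , x~y) → nonzero-residue p′ (countEdges G x y) x~y) clique)

  independent-bound : ∀ p .{{_ : NonZero p}} (I : List Point) →
                      IsIndependent (PowAdj G p {k}) I → IsIndependent (StrongCoAdj G {k}) I →
                      length I ≤ (k ℕ.* m ℕ.+ k / p) C (k / p)
  independent-bound p I indep strongIndep =
    edge-count-bound zeroIdeal (k / p) (λ j → + (suc (toℕ j) ℕ.* p)) multiple≢0 I
      (AllPairs.zipWith multiple (indep , strongIndep))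
    where
      multiple≢0 : ∀ (j : Fin (k / p)) → + (suc (toℕ j) ℕ.* p) ≢ 0ℤ
      multiple≢0 j jp≡0 = contradiction (ℕP.m*n≡0⇒m≡0 (suc (toℕ j)) p (ℤP.+-injective jp≡0)) λ ()
      multiple : ∀ {x y} → (x ≢ y × ¬ PowAdj G p x y) × (x ≢ y × ¬ StrongCoAdj G x y) →
                 ∃ λ j → + (suc (toℕ j) ℕ.* p) - + countEdges G x y ≡ 0ℤ
      multiple {x} {y} ((x≢y , ¬p∤) , (_ , ¬strong)) with
        positive-multiple p (countEdges G x y)
          (decidable-stable (countEdges G x y % p ℕ.≟ 0) ¬p∤)
          (¬strongCoAdj⇒countEdges≢0 G x y x≢y ¬strong) (countEdges≤ G x y)
      ... | j , jp≡N = j , trans (cong (λ t → + t - + countEdges G x y) jp≡N) (ℤP.+-inverseʳ (+ countEdges G x y))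

open import Data.Nat using (_+_; _*_)

C-suc : ∀ d a → a C d ≤ suc a C d
C-suc zero    a = ℕP.≤-refl
C-suc (suc d) a = subst (a C suc d ≤_) (nCk+nC[k+1]≡[n+1]C[k+1] a d) (ℕP.m≤n+m (a C suc d) (a C d))

C-monoˡ-≤ : ∀ d {a b} → a ≤ b → a C d ≤ b C d
C-monoˡ-≤ d = mono ∘ ℕP.≤⇒≤′
  where
    mono : ∀ {a b} → a ℕ.≤′ b → a C d ≤ b C d
    mono ℕ.≤′-refl        = ℕP.≤-refl
    mono (ℕ.≤′-step a≤′b) = ℕP.≤-trans (mono a≤′b) (C-suc d _)

no-points : ∀ {k B} (xs : List (Vec (Fin 0) (suc k))) → length xs ≤ B
no-points []              = z≤n
no-points ((() ∷ _) ∷ _)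

theorem5p1 : (n : ℕ) (G : Graph n) (p : ℕ) .{{_ : NonZero p}} → Prime p → (k : ℕ) → 1 ≤ k →
    CliqueNumberAtMost (PowAdj G p {k}) ((k * n + p ∸ 1) C (p ∸ 1))
    × (∀ (I : List (Vec (Fin n) k)) → IsIndependent (PowAdj G p {k}) I → IsIndependent (StrongCoAdj G {k}) I →
        length I ≤ (k * n + k / p) C (k / p))
    × (IsRegular G →
        CliqueNumberAtMost (PowAdj G p {k}) ((k * (n ∸ 1) + p) C (p ∸ 1))
        × (∀ (I : List (Vec (Fin n) k)) → IsIndependent (PowAdj G p {k}) I → IsIndependent (StrongCoAdj G {k}) I →
            length I ≤ (k * (n ∸ 1) + k / p + 1) C (k / p)))
theorem5p1 zero G p p-prime zero ()
theorem5p1 zero G p p-prime (suc k) _ =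
  (λ xs _ → no-points xs) , (λ I _ _ → no-points I) , λ _ → (λ xs _ → no-points xs) , (λ I _ _ → no-points I)
theorem5p1 (suc m) G zero p-prime k _ = contradiction p-prime ¬prime[0]
theorem5p1 (suc m) G (suc p′) p-prime k _ =
    (λ xs clique → relax p′ (clique-bound G k p′ p-prime xs clique) km+p′≤kn+p∸1)
  , (λ I indep strong → relax s (independent-bound G k p I indep strong) (ℕP.+-monoˡ-≤ s km≤kn))
  , λ _ → (λ xs clique → relax p′ (clique-bound G k p′ p-prime xs clique) (ℕP.+-monoʳ-≤ (k * m) (ℕP.n≤1+n p′)))
        , (λ I indep strong → relax s (independent-bound G k p I indep strong) (ℕP.m≤m+n (k * m + s) 1))
  where
    p = suc p′
    s = k / p
    relax : ∀ {x a b} d → x ≤ a C d → a ≤ b → x ≤ b C d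
    relax d x≤aCd a≤b = ℕP.≤-trans x≤aCd (C-monoˡ-≤ d a≤b)
    km≤kn : k * m ≤ k * suc m
    km≤kn = ℕP.*-monoʳ-≤ k (ℕP.n≤1+n m)
    km+p′≤kn+p∸1 : k * m + p′ ≤ k * suc m + p ∸ 1
    km+p′≤kn+p∸1 = subst (k * m + p′ ≤_) (cong (_∸ 1) (sym (ℕP.+-suc (k * suc m) p′))) (ℕP.+-monoˡ-≤ p′ km≤kn)
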